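{- For a trihex, the following are equivalent: (1) the trihex has 3-fold rotational symmetry, i.e., it can be embedded on the sphere so that a rotation of the sphere of order 3 induces a graph isomorphism (automorphism) of it; (2) all three of its equivalent signatures are the same triple of numbers; (3) at least two of its equivalent signatures are the same triple of numbers; (4) in the hexagonal tiling of the plane covering the trihex, every rotation by $60^\circ$ about the center of a special hexagon maps special hexagons to special hexagons; (5) in the hexagonal tiling of the plane covering the trihex, some rotation by $120^\circ$ maps special hexagons to special hexagons.
   Context: A trihex is a 3-regular graph embedded in the plane (equivalently the sphere) whose faces all have 3 or 6 sides, considered up to orientation-preserving homeomorphism. Every trihex arises as the quotient of the regular hexagonal tiling of the plane, positioned so that hexagons lie in vertical columns, by the group generated by the $180^\circ$ rotations about the centers of a set of "special" hexagons whose centers form the vertices of a parallelogram lattice; this tiling is the hexagonal tiling covering the trihex. Columns containing special hexagons are spine columns, the others are belt columns. The spine length $s\ge0$ is the number of hexagons strictly between two consecutive special hexagons in a spine column; $b\ge0$ is the number of belt columns between two adjacent spine columns; the offset $f$, $0\le f\le s$, is defined by: translating a special hexagon $b+1$ columns in the SW-to-NE direction lands it $f$ hexagons below a special hexagon. The triple $(s,b,f)$ is a signature. Repeating the construction with columns of hexagons in the directions $60^\circ$ and $120^\circ$ clockwise from north yields two more signatures; the three signatures are the equivalent signatures of the trihex. -}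

module Defs where

open import Data.Nat as ℕ using (ℕ; suc)
open import Data.Integer using (ℤ; +_; -_; _+_; _*_; _-_)
open import Data.Integer.Divisibility using (_∣_)
open import Data.Fin using (Fin; zero; suc)
open import Data.Product using (Σ; _×_; _,_; proj₁)
open import Data.Sum using (_⊎_)
open import Data.List using (List; []; _∷_)
open import Data.List.Relation.Unary.All using (All)
open import Relation.Binary.PropositionalEquality using (_≡_; _≢_)
open import Relation.Nullary using (¬_)

-- Hexagon centres of the hexagonal tiling (hexagons in vertical columns)
-- form a triangular lattice.  The pair (x , y) : Pt denotes the centre
--   x · e₂ + y · e₁
-- where e₁ is the step to the northern neighbour and e₂ the step to the
-- north-eastern neighbour (60° clockwise from north).  Hence hexagons with
-- equal x form one vertical column, and increasing x by one moves one
-- column in the SW-to-NE direction.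

Pt : Set
Pt = ℤ × ℤ

_⊕_ : Pt → Pt → Pt
(a , b) ⊕ (c , d) = (a + c , b + d)

_⊖_ : Pt → Pt → Pt
(a , b) ⊖ (c , d) = (a - c , b - d)

_⊙_ : ℤ → Pt → Pt
k ⊙ (a , b) = (k * a , k * b)

-- rotation by 60° counterclockwise about the centre (0 , 0):
-- e₁ ↦ e₁ - e₂ (north ↦ north-west), e₂ ↦ e₁ (north-east ↦ north)
ρ : Pt → Pt
ρ (x , y) = (- y , x + y)

ρ^ : ℕ → Pt → Pt
ρ^ ℕ.zero p = p
ρ^ (suc k) p = ρ (ρ^ k p)

det : Pt → Pt → ℤ
det (a , b) (c , d) = a * d - b * c

InLat : Pt → Pt → Pt → Set
InLat u v p = Σ ℤ λ a → Σ ℤ λ b → p ≡ (a ⊙ u) ⊕ (b ⊙ v)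

Special : Pt → Pt → Pt → Pt → Set
Special o u v p = InLat u v (p ⊖ o)

-- Everything is measured relative to a special
-- hexagon, i.e. in terms of the difference lattice Λ = ℤu + ℤv.
--  * adjacent spine columns are b+1 columns apart (b belt columns between):
--    every special hexagon lies in a column ≡ 0 mod (b+1) and column b+1
--    contains a special hexagon;
--  * consecutive special hexagons of a spine column are s+1 apart
--    (s hexagons strictly between them);
--  * translating a special hexagon b+1 columns in the SW-to-NE direction,
--    i.e. to (b+1 , 0), lands it f hexagons below a special hexagon,
--    i.e. (b+1 , f) is special; 0 ≤ f ≤ s.

Signature : Pt → Pt → ℕ × ℕ × ℕ → Set
Signature u v (s , b , f) =
  ((p : Pt) → InLat u v p → (+ suc b) ∣ proj₁ p) ×
  (Σ Pt λ p → InLat u v p × proj₁ p ≡ + suc b) ×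
  ((y : ℤ) → InLat u v (+ 0 , y) → (+ suc s) ∣ y) ×
  ((y : ℤ) → (+ suc s) ∣ y → InLat u v (+ 0 , y)) ×
  InLat u v (+ suc b , + f) ×
  f ℕ.≤ s

-- The k-th equivalent signature (k = 0, 1, 2): columns in the direction
-- 60k° clockwise from north.  Rotating the whole picture by 60k°
-- counterclockwise brings these columns (and the whole frame) to the
-- standard position, so this is the signature of the rotated lattice.
SigDir : ℕ → Pt → Pt → ℕ × ℕ × ℕ → Set
SigDir k u v t = Signature (ρ^ k u) (ρ^ k v) t

-- The hexagonal tiling as an oriented map, via darts.
-- A dart (h , i) is side i of hexagon h, traversed counterclockwise
-- around h; side i is shared with the neighbour h ⊕ dir i.

dir : Fin 6 → Pt
dir zero = (+ 0 , + 1)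
dir (suc zero) = (- + 1 , + 1)
dir (suc (suc zero)) = (- + 1 , + 0)
dir (suc (suc (suc zero))) = (+ 0 , - + 1)
dir (suc (suc (suc (suc zero)))) = (+ 1 , - + 1)
dir (suc (suc (suc (suc (suc zero))))) = (+ 1 , + 0)

next6 : Fin 6 → Fin 6
next6 zero = suc zero
next6 (suc zero) = suc (suc zero)
next6 (suc (suc zero)) = suc (suc (suc zero))
next6 (suc (suc (suc zero))) = suc (suc (suc (suc zero)))
next6 (suc (suc (suc (suc zero)))) = suc (suc (suc (suc (suc zero))))
next6 (suc (suc (suc (suc (suc zero))))) = zero

opp6 : Fin 6 → Fin 6
opp6 i = next6 (next6 (next6 i))

Dart : Set
Dart = Pt × Fin 6

faceNext : Dart → Dart
faceNext (h , i) = (h , next6 i)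

rev : Dart → Dart
rev (h , i) = (h ⊕ dir i , opp6 i)

rot180 : Pt → Dart → Dart
rot180 c (h , i) = (((+ 2) ⊙ c) ⊖ h , opp6 i)

act : List Pt → Dart → Dart
act [] d = d
act (c ∷ cs) d = rot180 c (act cs d)

-- d and d' lie in the same orbit of the group generated by the 180°
-- rotations about the special hexagons; the trihex is the quotient
-- of the tiling (as an oriented map) by this relation.
SameOrbit : Pt → Pt → Pt → Dart → Dart → Set
SameOrbit o u v d d' = Σ (List Pt) λ cs → All (Special o u v) cs × act cs d ≡ d'

-- (1) 3-fold rotational symmetry: an orientation-preserving automorphism
-- of order 3 of the quotient map (a self-map of darts, well defined on
-- orbits, commuting with edge reversal and the face permutation, whose
-- cube is the identity and which is not the identity).
ThreeFoldSymmetric : Pt → Pt → Pt → Set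
ThreeFoldSymmetric o u v =
  Σ (Dart → Dart) λ F →
    ((d d' : Dart) → SameOrbit o u v d d' → SameOrbit o u v (F d) (F d')) ×
    ((d : Dart) → SameOrbit o u v (F (rev d)) (rev (F d))) ×
    ((d : Dart) → SameOrbit o u v (F (faceNext d)) (faceNext (F d))) ×
    ((d : Dart) → SameOrbit o u v (F (F (F d))) d) ×
    (Σ Dart λ d → ¬ SameOrbit o u v (F d) d)

AllSignaturesEqual : Pt → Pt → Set
AllSignaturesEqual u v =
  Σ (ℕ × ℕ × ℕ) λ t → SigDir 0 u v t × SigDir 1 u v t × SigDir 2 u v t

TwoSignaturesEqual : Pt → Pt → Set
TwoSignaturesEqual u v =
  Σ (ℕ × ℕ × ℕ) λ t →
    (SigDir 0 u v t × SigDir 1 u v t) ⊎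
    (SigDir 0 u v t × SigDir 2 u v t) ⊎
    (SigDir 1 u v t × SigDir 2 u v t)

SixFoldAtSpecials : Pt → Pt → Pt → Set
SixFoldAtSpecials o u v =
  (c p : Pt) → Special o u v c → Special o u v p →
    Special o u v (c ⊕ ρ (p ⊖ c))

SomeThreeFoldRotation : Pt → Pt → Pt → Set
SomeThreeFoldRotation o u v =
  Σ Pt λ t → (p : Pt) → Special o u v p → Special o u v (ρ (ρ p) ⊕ t)

{-# OPTIONS --safe #-}
-- Every condition is equivalent to the lattice Λ = ℤu + ℤv of differences of
-- special hexagons being invariant under the 60° rotation ρ.
--
-- Signatures: (s , b , f) is a signature of Λ exactly when (b+1 , f), (0 , s+1)
-- is a basis of Λ (its Hermite normal form, which exists by Bézout).  The
-- signature in direction k is that of ρᵏΛ, so two equal signatures give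
-- ρΛ = Λ, ρ²Λ = Λ or ρΛ = ρ²Λ, and any of these forces ρΛ = Λ.
--
-- Symmetry: the tiling is connected, so an automorphism of the quotient map
-- agrees, up to orbits, with the motion h ↦ ρᵏ(h - o) + t matching it on one
-- dart.  Comparing the images of the darts (o , 0) and (2c - o , 3) for special
-- c shows that this motion respects orbits only if ρᵏΛ ⊆ Λ.  It has order 3 on
-- orbits only for k ≢ 0 mod 3: a half-turn is its own cube, and a translation
-- of order 3 on orbits is trivial on orbits.  Conversely the rotation by 120°
-- about o is such an automorphism when ρΛ = Λ.
module Submission where

open import Defs
open import Data.Integer using (ℤ)
open import Data.Product using (_×_)
open import Function.Bundles using (_⇔_)
open import Relation.Binary.PropositionalEquality using (_≢_)

open import Data.Nat as ℕ using (ℕ; zero; suc)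
import Data.Nat.Properties as ℕ
open import Data.Nat.GCD using (module Bézout; module GCD)
import Data.Nat.Divisibility as ℕ
open import Data.Integer using (+_; -_; _+_; _*_; _-_; -[1+_]; ∣_∣; _%ℕ_; _/ℕ_)
import Data.Integer.Properties as ℤP
open import Data.Integer.DivMod using (n%ℕd<d; a≡a%ℕn+[a/ℕn]*n)
open import Data.Integer.Divisibility using (_∣_)
import Data.Integer.Divisibility.Signed as Signed
open import Data.Integer.Tactic.RingSolver using (solve-∀)
open import Data.Fin using (Fin; zero; suc; toℕ)
open import Data.Product using (Σ; _,_; proj₁; proj₂)
open import Data.Sum using (_⊎_; inj₁; inj₂)
open import Data.List using ([]; _∷_; _++_; map)
open import Data.List.Relation.Unary.All using (All; []; _∷_)
import Data.List.Relation.Unary.All.Properties as All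
open import Data.Empty using (⊥-elim)
open import Function.Bundles using (mk⇔)
open import Function.Construct.Composition using (_⇔-∘_)
open import Function.Construct.Symmetry using (⇔-sym)
open import Relation.Binary.PropositionalEquality
open import Relation.Nullary using (¬_)

-- The ring solver does not look through the projections hidden in _⊕_, _⊖_ and
-- _⊙_, so identities of points are proved from ∀-identities of their components.
infixr 4 _,≡_
_,≡_ : {a b c d : ℤ} → a ≡ c → b ≡ d → _≡_ {A = Pt} (a , b) (c , d)
refl ,≡ refl = refl

ℤ-induction : (P : ℤ → Set) → P (+ 0) →
  (∀ z → P z → P (+ 1 + z)) → (∀ z → P z → P (- + 1 + z)) → ∀ z → P z
ℤ-induction P p₀ up down (+ zero) = p₀
ℤ-induction P p₀ up down (+ suc n) = up _ (ℤ-induction P p₀ up down (+ n))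
ℤ-induction P p₀ up down -[1+ zero ] = down _ p₀
ℤ-induction P p₀ up down -[1+ suc n ] = down _ (ℤ-induction P p₀ up down -[1+ n ])

0ᵖ : Pt
0ᵖ = (+ 0 , + 0)

-ᵖ_ : Pt → Pt
-ᵖ (x , y) = (- x , - y)

p⊖p≡0 : ∀ p → p ⊖ p ≡ 0ᵖ
p⊖p≡0 (p₁ , p₂) = lemma p₁ ,≡ lemma p₂
  where
  lemma : ∀ x → x - x ≡ + 0
  lemma = solve-∀

[p⊕q]⊖q≡p : ∀ p q → (p ⊕ q) ⊖ q ≡ p
[p⊕q]⊖q≡p (p₁ , p₂) (q₁ , q₂) = lemma p₁ q₁ ,≡ lemma p₂ q₂
  where
  lemma : ∀ x y → (x + y) - y ≡ x
  lemma = solve-∀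

[p⊖q]⊕q≡p : ∀ p q → (p ⊖ q) ⊕ q ≡ p
[p⊖q]⊕q≡p (p₁ , p₂) (q₁ , q₂) = lemma p₁ q₁ ,≡ lemma p₂ q₂
  where
  lemma : ∀ x y → (x - y) + y ≡ x
  lemma = solve-∀

[p⊕q]⊖p≡q : ∀ p q → (p ⊕ q) ⊖ p ≡ q
[p⊕q]⊖p≡q (p₁ , p₂) (q₁ , q₂) = lemma p₁ q₁ ,≡ lemma p₂ q₂
  where
  lemma : ∀ x y → (x + y) - x ≡ y
  lemma = solve-∀

p⊕[q⊖p]≡q : ∀ p q → p ⊕ (q ⊖ p) ≡ q
p⊕[q⊖p]≡q (p₁ , p₂) (q₁ , q₂) = lemma p₁ q₁ ,≡ lemma p₂ q₂
  where
  lemma : ∀ x y → x + (y - x) ≡ y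
  lemma = solve-∀

0⊕p≡p : ∀ p → 0ᵖ ⊕ p ≡ p
0⊕p≡p (p₁ , p₂) = ℤP.+-identityˡ p₁ ,≡ ℤP.+-identityˡ p₂

p⊕0≡p : ∀ p → p ⊕ 0ᵖ ≡ p
p⊕0≡p (p₁ , p₂) = ℤP.+-identityʳ p₁ ,≡ ℤP.+-identityʳ p₂

[p⊕q]⊖r≡[p⊖r]⊕q : ∀ p q r → (p ⊕ q) ⊖ r ≡ (p ⊖ r) ⊕ q
[p⊕q]⊖r≡[p⊖r]⊕q (p₁ , p₂) (q₁ , q₂) (r₁ , r₂) = lemma p₁ q₁ r₁ ,≡ lemma p₂ q₂ r₂
  where
  lemma : ∀ x y z → (x + y) - z ≡ (x - z) + y
  lemma = solve-∀

-- Lattices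

Sublattice : Pt → Pt → Pt → Pt → Set
Sublattice u v u′ v′ = ∀ {p} → InLat u v p → InLat u′ v′ p

module _ {u v : Pt} where

  InLat-0 : InLat u v 0ᵖ
  InLat-0 = + 0 , + 0 , lemma (proj₁ u) (proj₁ v) ,≡ lemma (proj₂ u) (proj₂ v)
    where
    lemma : ∀ x y → + 0 ≡ + 0 * x + + 0 * y
    lemma = solve-∀

  InLat-basisˡ : InLat u v u
  InLat-basisˡ = + 1 , + 0 , lemma (proj₁ u) (proj₁ v) ,≡ lemma (proj₂ u) (proj₂ v)
    where
    lemma : ∀ x y → x ≡ + 1 * x + + 0 * y
    lemma = solve-∀

  InLat-basisʳ : InLat u v v
  InLat-basisʳ = + 0 , + 1 , lemma (proj₁ u) (proj₁ v) ,≡ lemma (proj₂ u) (proj₂ v)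
    where
    lemma : ∀ x y → y ≡ + 0 * x + + 1 * y
    lemma = solve-∀

  InLat-⊕ : ∀ {p q} → InLat u v p → InLat u v q → InLat u v (p ⊕ q)
  InLat-⊕ (a , b , refl) (a′ , b′ , refl) =
    a + a′ , b + b′ , lemma a b a′ b′ (proj₁ u) (proj₁ v) ,≡ lemma a b a′ b′ (proj₂ u) (proj₂ v)
    where
    lemma : ∀ a b a′ b′ x y → (a * x + b * y) + (a′ * x + b′ * y) ≡ (a + a′) * x + (b + b′) * y
    lemma = solve-∀

  InLat-⊙ : ∀ k {p} → InLat u v p → InLat u v (k ⊙ p)
  InLat-⊙ k (a , b , refl) =
    k * a , k * b , lemma k a b (proj₁ u) (proj₁ v) ,≡ lemma k a b (proj₂ u) (proj₂ v)
    where
    lemma : ∀ k a b x y → k * (a * x + b * y) ≡ (k * a) * x + (k * b) * y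
    lemma = solve-∀

  InLat-⊖ : ∀ {p q} → InLat u v p → InLat u v q → InLat u v (p ⊖ q)
  InLat-⊖ {p} {q} lp lq =
    subst (InLat u v) (lemma p q) (InLat-⊕ lp (InLat-⊙ (- + 1) lq))
    where
    lemma′ : ∀ x y → x + - + 1 * y ≡ x - y
    lemma′ = solve-∀
    lemma : ∀ p q → p ⊕ ((- + 1) ⊙ q) ≡ p ⊖ q
    lemma (p₁ , p₂) (q₁ , q₂) = lemma′ p₁ q₁ ,≡ lemma′ p₂ q₂

  InLat-double : ∀ {p} → InLat u v p → InLat ((+ 2) ⊙ u) ((+ 2) ⊙ v) ((+ 2) ⊙ p)
  InLat-double (a , b , refl) = a , b , lemma a b (proj₁ u) (proj₁ v) ,≡ lemma a b (proj₂ u) (proj₂ v)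
    where
    lemma : ∀ a b x y → + 2 * (a * x + b * y) ≡ a * (+ 2 * x) + b * (+ 2 * y)
    lemma = solve-∀

  InLat-halve : ∀ {p} → InLat ((+ 2) ⊙ u) ((+ 2) ⊙ v) ((+ 2) ⊙ p) → InLat u v p
  InLat-halve {p₁ , p₂} (a , b , e) =
    a , b , halve a b p₁ (proj₁ u) (proj₁ v) (cong proj₁ e) ,≡
            halve a b p₂ (proj₂ u) (proj₂ v) (cong proj₂ e)
    where
    lemma : ∀ a b x y → a * (+ 2 * x) + b * (+ 2 * y) ≡ + 2 * (a * x + b * y)
    lemma = solve-∀
    halve : ∀ a b z x y → + 2 * z ≡ a * (+ 2 * x) + b * (+ 2 * y) → z ≡ a * x + b * y
    halve a b z x y e = ℤP.*-cancelˡ-≡ (+ 2) _ _ (trans e (lemma a b x y))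

Sublattice-generated : ∀ {u v u′ v′} → InLat u′ v′ u → InLat u′ v′ v → Sublattice u v u′ v′
Sublattice-generated lu lv (a , b , refl) = InLat-⊕ (InLat-⊙ a lu) (InLat-⊙ b lv)

ρ-⊕ : ∀ p q → ρ (p ⊕ q) ≡ ρ p ⊕ ρ q
ρ-⊕ (p₁ , p₂) (q₁ , q₂) = lemma₁ p₂ q₂ ,≡ lemma₂ p₁ p₂ q₁ q₂
  where
  lemma₁ : ∀ a b → - (a + b) ≡ - a + - b
  lemma₁ = solve-∀
  lemma₂ : ∀ a b c d → (a + c) + (b + d) ≡ (a + b) + (c + d)
  lemma₂ = solve-∀

ρ-⊖ : ∀ p q → ρ (p ⊖ q) ≡ ρ p ⊖ ρ q
ρ-⊖ (p₁ , p₂) (q₁ , q₂) = lemma₁ p₂ q₂ ,≡ lemma₂ p₁ p₂ q₁ q₂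
  where
  lemma₁ : ∀ a b → - (a - b) ≡ - a - - b
  lemma₁ = solve-∀
  lemma₂ : ∀ a b c d → (a - c) + (b - d) ≡ (a + b) - (c + d)
  lemma₂ = solve-∀

ρ-⊙ : ∀ k p → ρ (k ⊙ p) ≡ k ⊙ ρ p
ρ-⊙ k (p₁ , p₂) = lemma₁ k p₂ ,≡ lemma₂ k p₁ p₂
  where
  lemma₁ : ∀ k a → - (k * a) ≡ k * (- a)
  lemma₁ = solve-∀
  lemma₂ : ∀ k a b → k * a + k * b ≡ k * (a + b)
  lemma₂ = solve-∀

ρ^-⊕ : ∀ k p q → ρ^ k (p ⊕ q) ≡ ρ^ k p ⊕ ρ^ k q
ρ^-⊕ zero p q = refl
ρ^-⊕ (suc k) p q = trans (cong ρ (ρ^-⊕ k p q)) (ρ-⊕ (ρ^ k p) (ρ^ k q))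

ρ^-⊖ : ∀ k p q → ρ^ k (p ⊖ q) ≡ ρ^ k p ⊖ ρ^ k q
ρ^-⊖ zero p q = refl
ρ^-⊖ (suc k) p q = trans (cong ρ (ρ^-⊖ k p q)) (ρ-⊖ (ρ^ k p) (ρ^ k q))

ρ^-⊙ : ∀ k c p → ρ^ k (c ⊙ p) ≡ c ⊙ ρ^ k p
ρ^-⊙ zero c p = refl
ρ^-⊙ (suc k) c p = trans (cong ρ (ρ^-⊙ k c p)) (ρ-⊙ c (ρ^ k p))

ρ^-0 : ∀ k → ρ^ k 0ᵖ ≡ 0ᵖ
ρ^-0 zero = refl
ρ^-0 (suc k) = cong ρ (ρ^-0 k)

ρ^-+ : ∀ m n p → ρ^ (m ℕ.+ n) p ≡ ρ^ m (ρ^ n p)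
ρ^-+ zero n p = refl
ρ^-+ (suc m) n p = cong ρ (ρ^-+ m n p)

ρ³≡-ᵖ : ∀ p → ρ^ 3 p ≡ -ᵖ p
ρ³≡-ᵖ (x , y) = lemma₁ x y ,≡ lemma₂ x y
  where
  lemma₁ : ∀ x y → - (- y + (x + y)) ≡ - x
  lemma₁ = solve-∀
  lemma₂ : ∀ x y → - (x + y) + (- y + (x + y)) ≡ - y
  lemma₂ = solve-∀

ρ⁶≡id : ∀ p → ρ^ 6 p ≡ p
ρ⁶≡id p = trans (ρ³≡-ᵖ (ρ^ 3 p)) (trans (cong -ᵖ_ (ρ³≡-ᵖ p)) (-ᵖ-involutive p))
  where
  -ᵖ-involutive : ∀ p → -ᵖ (-ᵖ p) ≡ p
  -ᵖ-involutive (x , y) = ℤP.neg-involutive x ,≡ ℤP.neg-involutive y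

InLat-ρ^ : ∀ {u v p} k → InLat u v p → InLat (ρ^ k u) (ρ^ k v) (ρ^ k p)
InLat-ρ^ {u} {v} k (a , b , refl) = a , b , trans (ρ^-⊕ k _ _) (cong₂ _⊕_ (ρ^-⊙ k a u) (ρ^-⊙ k b v))

InLat-ρ^⁻¹ : ∀ {u v q} k → InLat (ρ^ k u) (ρ^ k v) q → Σ Pt λ p → InLat u v p × q ≡ ρ^ k p
InLat-ρ^⁻¹ {u} {v} k (a , b , refl) =
  (a ⊙ u) ⊕ (b ⊙ v) , (a , b , refl) ,
  sym (trans (ρ^-⊕ k _ _) (cong₂ _⊕_ (ρ^-⊙ k a u) (ρ^-⊙ k b v)))

-- Rotation-invariant lattices

ClosedUnderρ^ : ℕ → Pt → Pt → Set
ClosedUnderρ^ k u v = ∀ {p} → InLat u v p → InLat u v (ρ^ k p)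

RotationClosed : Pt → Pt → Set
RotationClosed = ClosedUnderρ^ 1

module _ {u v : Pt} where

  closedUnderρ^-+ : ∀ {m n} →
    ClosedUnderρ^ m u v → ClosedUnderρ^ n u v → ClosedUnderρ^ (m ℕ.+ n) u v
  closedUnderρ^-+ {m} {n} cm cn {p} l = subst (InLat u v) (sym (ρ^-+ m n p)) (cm (cn l))

  closedUnderρ^-mod6 : ∀ {k} → ClosedUnderρ^ (6 ℕ.+ k) u v → ClosedUnderρ^ k u v
  closedUnderρ^-mod6 {k} c {p} l = subst (InLat u v) (trans (ρ^-+ 6 k p) (ρ⁶≡id (ρ^ k p))) (c l)

  closedUnderρ³ : ClosedUnderρ^ 3 u v
  closedUnderρ³ {p} l = subst (InLat u v) (trans (lemma p) (sym (ρ³≡-ᵖ p))) (InLat-⊖ InLat-0 l)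
    where
    lemma′ : ∀ x → + 0 - x ≡ - x
    lemma′ = solve-∀
    lemma : ∀ p → 0ᵖ ⊖ p ≡ -ᵖ p
    lemma (p₁ , p₂) = lemma′ p₁ ,≡ lemma′ p₂

  rotationClosed⇒closedUnderρ^ : RotationClosed u v → ∀ k → ClosedUnderρ^ k u v
  rotationClosed⇒closedUnderρ^ c zero l = l
  rotationClosed⇒closedUnderρ^ c (suc k) l = c (rotationClosed⇒closedUnderρ^ c k l)

  closedUnderρ⁴⇒rotationClosed : ClosedUnderρ^ 4 u v → RotationClosed u v
  closedUnderρ⁴⇒rotationClosed c = closedUnderρ^-mod6 {1} (closedUnderρ^-+ {4} {3} c closedUnderρ³)

  closedUnderρ²⇒rotationClosed : ClosedUnderρ^ 2 u v → RotationClosed u v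
  closedUnderρ²⇒rotationClosed c = closedUnderρ⁴⇒rotationClosed (closedUnderρ^-+ {2} {2} c c)

  closedUnderρ⁵⇒rotationClosed : ClosedUnderρ^ 5 u v → RotationClosed u v
  closedUnderρ⁵⇒rotationClosed c =
    closedUnderρ⁴⇒rotationClosed (closedUnderρ^-mod6 {4} (closedUnderρ^-+ {5} {5} c c))

  rotatedBasis⊆ : RotationClosed u v → ∀ k → Sublattice (ρ^ k u) (ρ^ k v) u v
  rotatedBasis⊆ c k = Sublattice-generated
    (rotationClosed⇒closedUnderρ^ c k InLat-basisˡ) (rotationClosed⇒closedUnderρ^ c k InLat-basisʳ)

  ⊆rotatedBasis : RotationClosed u v → ∀ k → Sublattice u v (ρ^ k u) (ρ^ k v)
  ⊆rotatedBasis c zero l = l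
  ⊆rotatedBasis c (suc k) {p} l =
    subst (InLat _ _) (ρ⁶≡id p) (InLat-ρ^ 1 (⊆rotatedBasis c k (rotationClosed⇒closedUnderρ^ c 5 l)))

-- Signatures

Signature-transport : ∀ {u v u′ v′ t} → Sublattice u v u′ v′ → Sublattice u′ v′ u v →
  Signature u v t → Signature u′ v′ t
Signature-transport Λ⊆Λ′ Λ′⊆Λ (columns , (p , lp , ep) , spine , spine⁻¹ , offset , f≤s) =
  (λ p l → columns p (Λ′⊆Λ l)) , (p , Λ⊆Λ′ lp , ep) , (λ y l → spine y (Λ′⊆Λ l)) ,
  (λ y d → Λ⊆Λ′ (spine⁻¹ y d)) , Λ⊆Λ′ offset , f≤s

signature⇒⊆triangular : ∀ {u v s b f} → Signature u v (s , b , f) →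
  Sublattice u v (+ suc b , + f) (+ 0 , + suc s)
signature⇒⊆triangular {u} {v} {s} {b} {f} (columns , _ , spine , _ , offset , _) {x , y} l =
  decompose x y l (Signed.∣ᵤ⇒∣ (columns (x , y) l))
  where
  spine-part : ∀ k y → InLat u v (k * + suc b , y) → InLat u v (+ 0 , y - k * + f)
  spine-part k y l = subst (InLat u v) (ℤP.+-inverseʳ (k * + suc b) ,≡ refl) (InLat-⊖ l (InLat-⊙ k offset))
  lemma₁ : ∀ k n m → k * n ≡ k * n + m * + 0
  lemma₁ = solve-∀
  lemma₂ : ∀ y z → y ≡ z + (y - z)
  lemma₂ = solve-∀
  decompose : ∀ x y → InLat u v (x , y) → + suc b Signed.∣ x →
    InLat (+ suc b , + f) (+ 0 , + suc s) (x , y)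
  decompose .(k * + suc b) y l (Signed.divides k refl)
    with Signed.∣ᵤ⇒∣ (spine (y - k * + f) (spine-part k y l))
  ... | Signed.divides m e =
    k , m , lemma₁ k (+ suc b) m ,≡ trans (lemma₂ y (k * + f)) (cong (_+_ (k * + f)) e)

triangular⊆signature : ∀ {u v s b f} → Signature u v (s , b , f) →
  Sublattice (+ suc b , + f) (+ 0 , + suc s) u v
triangular⊆signature {s = s} (_ , _ , _ , spine⁻¹ , offset , _) =
  Sublattice-generated offset (spine⁻¹ (+ suc s) ℕ.∣-refl)

signature-determines-lattice : ∀ {u v u′ v′ s b f} →
  Signature u v (s , b , f) → Signature u′ v′ (s , b , f) → Sublattice u v u′ v′
signature-determines-lattice σ σ′ l = triangular⊆signature σ′ (signature⇒⊆triangular σ l)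

triangular-signature : ∀ b s y → Signature (+ suc b , y) (+ 0 , + suc s) (s , b , y %ℕ suc s)
triangular-signature b s y =
  columns , ((+ suc b , y) , InLat-basisˡ , refl) , spine , spine⁻¹ , offset ,
  ℕ.≤-pred (n%ℕd<d y (suc s))
  where
  Λ : Pt → Set
  Λ = InLat (+ suc b , y) (+ 0 , + suc s)
  lemma₁ : ∀ k n m → k * n + m * + 0 ≡ k * n
  lemma₁ = solve-∀
  lemma₂ : ∀ y m n → + 0 * y + m * n ≡ m * n
  lemma₂ = solve-∀
  lemma₃ : ∀ r q n → r ≡ + 1 * (r + q * n) + - q * n
  lemma₃ = solve-∀
  lemma₄ : ∀ n m → + 1 * n + m * + 0 ≡ n
  lemma₄ = solve-∀
  columns : ∀ p → Λ p → + suc b ∣ proj₁ p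
  columns _ (k , m , refl) = Signed.∣⇒∣ᵤ (Signed.divides k (lemma₁ k (+ suc b) m))
  spine : ∀ z → Λ (+ 0 , z) → + suc s ∣ z
  spine z (k , m , e) = Signed.∣⇒∣ᵤ (Signed.divides m (trans (cong proj₂ e)
    (trans (cong (λ k → k * y + m * + suc s) k≡0) (lemma₂ y m (+ suc s)))))
    where
    k≡0 : k ≡ + 0
    k≡0 = ℤP.*-cancelʳ-≡ k (+ 0) (+ suc b) (trans (sym (lemma₁ k (+ suc b) m)) (sym (cong proj₁ e)))
  spine⁻¹ : ∀ z → + suc s ∣ z → Λ (+ 0 , z)
  spine⁻¹ z d with Signed.∣ᵤ⇒∣ {+ suc s} {z} d
  ... | Signed.divides m refl = + 0 , m , sym (lemma₁ (+ 0) (+ suc b) m) ,≡ sym (lemma₂ y m (+ suc s))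
  offset : Λ (+ suc b , + (y %ℕ suc s))
  offset = + 1 , - (y /ℕ suc s) ,
    sym (lemma₄ (+ suc b) (- (y /ℕ suc s))) ,≡
    trans (lemma₃ (+ (y %ℕ suc s)) (y /ℕ suc s) (+ suc s))
          (cong (λ z → + 1 * z + - (y /ℕ suc s) * + suc s) (sym (a≡a%ℕn+[a/ℕn]*n y (suc s))))

sign-abs : ∀ a → Σ ℤ λ σ → a ≡ σ * + ∣ a ∣ × + ∣ a ∣ ≡ σ * a
sign-abs (+ n) = + 1 , sym (ℤP.*-identityˡ (+ n)) , sym (ℤP.*-identityˡ (+ n))
sign-abs -[1+ n ] = - + 1 , sym (ℤP.-1*i≡-i (+ suc n)) , sym (ℤP.-1*i≡-i -[1+ n ])

nonzero-sign-abs : ∀ a → a ≢ + 0 → Σ ℕ λ n → Σ ℤ λ σ → a ≡ σ * + suc n × + suc n ≡ σ * a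
nonzero-sign-abs (+ zero) a≢0 = ⊥-elim (a≢0 refl)
nonzero-sign-abs (+ suc n) _ = n , sign-abs (+ suc n)
nonzero-sign-abs -[1+ n ] _ = n , sign-abs -[1+ n ]

integer-bézout : ∀ a c → Σ ℕ λ g → Σ ℤ λ a′ → Σ ℤ λ c′ →
  a ≡ + g * a′ × c ≡ + g * c′ × Σ ℤ λ α → Σ ℤ λ β → α * a + β * c ≡ + g
integer-bézout a c with Bézout.lemma ∣ a ∣ ∣ c ∣ | sign-abs a | sign-abs c
... | Bézout.result g gcd identity | σ , a≡σ∣a∣ , ∣a∣≡σa | τ , c≡τ∣c∣ , ∣c∣≡τc
  with GCD.gcd∣m gcd | GCD.gcd∣n gcd
... | ℕ.divides p ∣a∣≡pg | ℕ.divides q ∣c∣≡qg =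
  g , σ * + p , τ * + q , factor a σ p a≡σ∣a∣ ∣a∣≡pg , factor c τ q c≡τ∣c∣ ∣c∣≡qg ,
  combination identity
  where
  lemma₁ : ∀ σ p g → σ * (p * g) ≡ g * (σ * p)
  lemma₁ = solve-∀
  lemma₂ : ∀ x y σ a τ c → (x * σ) * a + (- y * τ) * c ≡ x * (σ * a) - y * (τ * c)
  lemma₂ = solve-∀
  lemma₃ : ∀ g n → g ≡ (g + n) - n
  lemma₃ = solve-∀
  factor : ∀ x σ p → x ≡ σ * + ∣ x ∣ → ∣ x ∣ ≡ p ℕ.* g → x ≡ + g * (σ * + p)
  factor x σ p x≡σ∣x∣ ∣x∣≡pg =
    trans x≡σ∣x∣ (trans (cong (λ n → σ * + n) ∣x∣≡pg)
      (trans (cong (σ *_) (ℤP.pos-* p g)) (lemma₁ σ (+ p) (+ g))))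
  ℕ-identity⇒ℤ : ∀ x y m n → g ℕ.+ y ℕ.* n ≡ x ℕ.* m → + g ≡ + x * + m - + y * + n
  ℕ-identity⇒ℤ x y m n e = trans (lemma₃ (+ g) (+ y * + n))
    (cong (_- + y * + n) (trans (cong (_+_ (+ g)) (sym (ℤP.pos-* y n)))
      (trans (sym (ℤP.pos-+ g (y ℕ.* n))) (trans (cong +_ e) (ℤP.pos-* x m)))))
  combination : Bézout.Identity g ∣ a ∣ ∣ c ∣ → Σ ℤ λ α → Σ ℤ λ β → α * a + β * c ≡ + g
  combination (Bézout.+- x y e) = + x * σ , - + y * τ ,
    trans (lemma₂ (+ x) (+ y) σ a τ c)
      (trans (cong₂ (λ m n → + x * m - + y * n) (sym ∣a∣≡σa) (sym ∣c∣≡τc))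
             (sym (ℕ-identity⇒ℤ x y ∣ a ∣ ∣ c ∣ e)))
  combination (Bézout.-+ x y e) = - + x * σ , + y * τ ,
    trans (trans (ℤP.+-comm (- + x * σ * a) (+ y * τ * c)) (lemma₂ (+ y) (+ x) τ c σ a))
      (trans (cong₂ (λ n m → + y * n - + x * m) (sym ∣c∣≡τc) (sym ∣a∣≡σa))
             (sym (ℕ-identity⇒ℤ y x ∣ c ∣ ∣ a ∣ e)))

Sublattice-rescaleʳ : ∀ {w z z′} σ → z ≡ σ ⊙ z′ → Sublattice w z w z′
Sublattice-rescaleʳ σ refl = Sublattice-generated InLat-basisˡ (InLat-⊙ σ InLat-basisʳ)

module _ (g a′ c′ b e α β : ℤ) (bézout : α * a′ + β * c′ ≡ + 1) where

  private
    scaled : ∀ x → x ≡ x * (α * a′ + β * c′)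
    scaled x = trans (sym (ℤP.*-identityʳ x)) (cong (x *_) (sym bézout))

  bézoutBasis⊆ : Sublattice (g , α * b + β * e) (+ 0 , a′ * e - b * c′) (g * a′ , b) (g * c′ , e)
  bézoutBasis⊆ = Sublattice-generated
    (α , β , trans (scaled g) (lemma₁ g α a′ β c′) ,≡ refl)
    (- c′ , a′ , lemma₂ g a′ c′ ,≡ lemma₃ a′ e b c′)
    where
    lemma₁ : ∀ g α a′ β c′ → g * (α * a′ + β * c′) ≡ α * (g * a′) + β * (g * c′)
    lemma₁ = solve-∀
    lemma₂ : ∀ g a′ c′ → + 0 ≡ - c′ * (g * a′) + a′ * (g * c′)
    lemma₂ = solve-∀
    lemma₃ : ∀ a′ e b c′ → a′ * e - b * c′ ≡ - c′ * b + a′ * e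
    lemma₃ = solve-∀

  ⊆bézoutBasis : Sublattice (g * a′ , b) (g * c′ , e) (g , α * b + β * e) (+ 0 , a′ * e - b * c′)
  ⊆bézoutBasis = Sublattice-generated
    (a′ , - β , lemma₁ g a′ (- β) ,≡ trans (scaled b) (lemma₂ α a′ β c′ b e))
    (c′ , α , lemma₁ g c′ α ,≡ trans (scaled e) (lemma₃ α a′ β c′ b e))
    where
    lemma₁ : ∀ g a′ k → g * a′ ≡ a′ * g + k * + 0
    lemma₁ = solve-∀
    lemma₂ : ∀ α a′ β c′ b e →
      b * (α * a′ + β * c′) ≡ a′ * (α * b + β * e) + - β * (a′ * e - b * c′)
    lemma₂ = solve-∀
    lemma₃ : ∀ α a′ β c′ b e →
      e * (α * a′ + β * c′) ≡ c′ * (α * b + β * e) + α * (a′ * e - b * c′)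
    lemma₃ = solve-∀

hermite-normal-form : ∀ u v → det u v ≢ + 0 → Σ ℕ λ b → Σ ℕ λ s → Σ ℤ λ y →
  Sublattice u v (+ suc b , y) (+ 0 , + suc s) × Sublattice (+ suc b , y) (+ 0 , + suc s) u v
hermite-normal-form (a , b) (c , e) det≢0 with integer-bézout a c
... | zero , a′ , c′ , refl , refl , _ = ⊥-elim (det≢0 (lemma a′ b c′ e))
  where
  lemma : ∀ a′ b c′ e → (+ 0 * a′) * e - b * (+ 0 * c′) ≡ + 0
  lemma = solve-∀
... | suc g , a′ , c′ , refl , refl , α , β , bézout =
  let s , σ , D≡σm , m≡σD = nonzero-sign-abs D D≢0 in
  g , s , α * b + β * e ,
  (λ l → Sublattice-rescaleʳ σ (sym (ℤP.*-zeroʳ σ) ,≡ D≡σm)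
           (⊆bézoutBasis G a′ c′ b e α β one l)) ,
  (λ l → bézoutBasis⊆ G a′ c′ b e α β one
           (Sublattice-rescaleʳ σ (sym (ℤP.*-zeroʳ σ) ,≡ m≡σD) l))
  where
  G D : ℤ
  G = + suc g
  D = a′ * e - b * c′
  lemma₁ : ∀ G a′ b c′ e → (G * a′) * e - b * (G * c′) ≡ G * (a′ * e - b * c′)
  lemma₁ = solve-∀
  lemma₂ : ∀ G α a′ β c′ → G * (α * a′ + β * c′) ≡ α * (G * a′) + β * (G * c′)
  lemma₂ = solve-∀
  D≢0 : D ≢ + 0
  D≢0 D≡0 = det≢0 (trans (lemma₁ G a′ b c′ e) (trans (cong (G *_) D≡0) (ℤP.*-zeroʳ G)))
  one : α * a′ + β * c′ ≡ + 1
  one = ℤP.*-cancelˡ-≡ G _ _ (trans (lemma₂ G α a′ β c′) (trans bézout (sym (ℤP.*-identityʳ G))))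

signature-exists : ∀ {u v} → det u v ≢ + 0 → Σ (ℕ × ℕ × ℕ) (Signature u v)
signature-exists {u} {v} det≢0 with hermite-normal-form u v det≢0
... | b , s , y , Λ⊆T , T⊆Λ =
  (s , b , y %ℕ suc s) , Signature-transport T⊆Λ Λ⊆T (triangular-signature b s y)

module SignatureConditions (u v : Pt) where

  allSignaturesEqual⇒twoSignaturesEqual : AllSignaturesEqual u v → TwoSignaturesEqual u v
  allSignaturesEqual⇒twoSignaturesEqual (t , σ₀ , σ₁ , _) = t , inj₁ (σ₀ , σ₁)

  Signature-rotate : ∀ {t} → RotationClosed u v → Signature u v t → ∀ k → SigDir k u v t
  Signature-rotate closed σ k = Signature-transport (⊆rotatedBasis closed k) (rotatedBasis⊆ closed k) σ

  rotationClosed⇒allSignaturesEqual : det u v ≢ + 0 → RotationClosed u v → AllSignaturesEqual u v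
  rotationClosed⇒allSignaturesEqual det≢0 closed =
    let t , σ = signature-exists det≢0 in t , σ , Signature-rotate closed σ 1 , Signature-rotate closed σ 2

  twoSignaturesEqual⇒rotationClosed : TwoSignaturesEqual u v → RotationClosed u v
  twoSignaturesEqual⇒rotationClosed (_ , inj₁ (σ₀ , σ₁)) l =
    signature-determines-lattice σ₁ σ₀ (InLat-ρ^ 1 l)
  twoSignaturesEqual⇒rotationClosed (_ , inj₂ (inj₁ (σ₀ , σ₂))) =
    closedUnderρ²⇒rotationClosed λ l → signature-determines-lattice σ₂ σ₀ (InLat-ρ^ 2 l)
  twoSignaturesEqual⇒rotationClosed (_ , inj₂ (inj₂ (σ₁ , σ₂))) =
    closedUnderρ⁵⇒rotationClosed λ {p} l →
      unrotate {p} (InLat-ρ^⁻¹ 2 (signature-determines-lattice σ₁ σ₂ (InLat-ρ^ 1 l)))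
    where
    unrotate : ∀ {p} → (Σ Pt λ q → InLat u v q × ρ p ≡ ρ^ 2 q) → InLat u v (ρ^ 5 p)
    unrotate (q , lq , ρp≡ρ²q) = subst (InLat u v) (sym (trans (cong (ρ^ 4) ρp≡ρ²q) (ρ⁶≡id q))) lq

  allSignaturesEqual⇒rotationClosed : AllSignaturesEqual u v → RotationClosed u v
  allSignaturesEqual⇒rotationClosed all =
    twoSignaturesEqual⇒rotationClosed (allSignaturesEqual⇒twoSignaturesEqual all)

  rotationClosed⇒twoSignaturesEqual : det u v ≢ + 0 → RotationClosed u v → TwoSignaturesEqual u v
  rotationClosed⇒twoSignaturesEqual det≢0 closed =
    allSignaturesEqual⇒twoSignaturesEqual (rotationClosed⇒allSignaturesEqual det≢0 closed)

module SpecialHexagons (o u v : Pt) where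

  Special-centre : Special o u v o
  Special-centre = subst (InLat u v) (sym (p⊖p≡0 o)) InLat-0

  Special-shift : ∀ {p} → InLat u v p → Special o u v (o ⊕ p)
  Special-shift {p} = subst (InLat u v) (sym ([p⊕q]⊖p≡q o p))

  sixFold⇒rotationClosed : SixFoldAtSpecials o u v → RotationClosed u v
  sixFold⇒rotationClosed sixFold {p} l =
    subst (InLat u v) (trans ([p⊕q]⊖p≡q o _) (cong ρ ([p⊕q]⊖p≡q o p)))
      (sixFold o (o ⊕ p) Special-centre (Special-shift l))

  rotationClosed⇒sixFold : RotationClosed u v → SixFoldAtSpecials o u v
  rotationClosed⇒sixFold closed c p sc sp =
    subst (InLat u v)
      (sym (trans ([p⊕q]⊖r≡[p⊖r]⊕q c _ o) (cong (λ x → (c ⊖ o) ⊕ ρ x) (lemma p c o))))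
      (InLat-⊕ sc (closed (InLat-⊖ sp sc)))
    where
    lemma′ : ∀ p c o → p - c ≡ (p - o) - (c - o)
    lemma′ = solve-∀
    lemma : ∀ p c o → p ⊖ c ≡ (p ⊖ o) ⊖ (c ⊖ o)
    lemma (p₁ , p₂) (c₁ , c₂) (o₁ , o₂) = lemma′ p₁ c₁ o₁ ,≡ lemma′ p₂ c₂ o₂

  rotationClosed⇒someThreeFold : RotationClosed u v → SomeThreeFoldRotation o u v
  rotationClosed⇒someThreeFold closed = o ⊖ ρ^ 2 o , λ p sp →
    subst (InLat u v) (trans (ρ^-⊖ 2 p o) (lemma (ρ^ 2 p) (ρ^ 2 o) o))
      (rotationClosed⇒closedUnderρ^ closed 2 sp)
    where
    lemma′ : ∀ x y o → x - y ≡ (x + (o - y)) - o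
    lemma′ = solve-∀
    lemma : ∀ x y o → x ⊖ y ≡ (x ⊕ (o ⊖ y)) ⊖ o
    lemma (x₁ , x₂) (y₁ , y₂) (o₁ , o₂) = lemma′ x₁ y₁ o₁ ,≡ lemma′ x₂ y₂ o₂

  someThreeFold⇒rotationClosed : SomeThreeFoldRotation o u v → RotationClosed u v
  someThreeFold⇒rotationClosed (t , threeFold) = closedUnderρ²⇒rotationClosed λ {p} l →
    subst (InLat u v)
      (trans (cong (λ x → ((x ⊕ t) ⊖ o) ⊖ ((ρ^ 2 o ⊕ t) ⊖ o)) (ρ^-⊕ 2 o p))
             (lemma (ρ^ 2 o) (ρ^ 2 p) t o))
      (InLat-⊖ (threeFold (o ⊕ p) (Special-shift l)) (threeFold o Special-centre))
    where
    lemma′ : ∀ x y t o → (((x + y) + t) - o) - ((x + t) - o) ≡ y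
    lemma′ = solve-∀
    lemma : ∀ x y t o → (((x ⊕ y) ⊕ t) ⊖ o) ⊖ ((x ⊕ t) ⊖ o) ≡ y
    lemma (x₁ , x₂) (y₁ , y₂) (t₁ , t₂) (o₁ , o₂) =
      lemma′ x₁ y₁ t₁ o₁ ,≡ lemma′ x₂ y₂ t₂ o₂

-- Darts and motions

next6^ : ℕ → Fin 6 → Fin 6
next6^ zero i = i
next6^ (suc k) i = next6 (next6^ k i)

next6^-next6 : ∀ k i → next6^ k (next6 i) ≡ next6 (next6^ k i)
next6^-next6 zero i = refl
next6^-next6 (suc k) i = cong next6 (next6^-next6 k i)

next6^-opp6 : ∀ k i → next6^ k (opp6 i) ≡ opp6 (next6^ k i)
next6^-opp6 k i = trans (next6^-next6 k (next6 (next6 i)))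
  (cong next6 (trans (next6^-next6 k (next6 i)) (cong next6 (next6^-next6 k i))))

next6^-+ : ∀ m n i → next6^ (m ℕ.+ n) i ≡ next6^ m (next6^ n i)
next6^-+ zero n i = refl
next6^-+ (suc m) n i = cong next6 (next6^-+ m n i)

next6⁶≡id : ∀ i → next6^ 6 i ≡ i
next6⁶≡id zero = refl
next6⁶≡id (suc zero) = refl
next6⁶≡id (suc (suc zero)) = refl
next6⁶≡id (suc (suc (suc zero))) = refl
next6⁶≡id (suc (suc (suc (suc zero)))) = refl
next6⁶≡id (suc (suc (suc (suc (suc zero))))) = refl

next6^-toℕ : ∀ i → next6^ (toℕ i) zero ≡ i
next6^-toℕ zero = refl
next6^-toℕ (suc zero) = refl
next6^-toℕ (suc (suc zero)) = refl
next6^-toℕ (suc (suc (suc zero))) = refl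
next6^-toℕ (suc (suc (suc (suc zero)))) = refl
next6^-toℕ (suc (suc (suc (suc (suc zero))))) = refl

next6^-to-zero : ∀ i → next6^ (6 ℕ.∸ toℕ i) i ≡ zero
next6^-to-zero zero = refl
next6^-to-zero (suc zero) = refl
next6^-to-zero (suc (suc zero)) = refl
next6^-to-zero (suc (suc (suc zero))) = refl
next6^-to-zero (suc (suc (suc (suc zero)))) = refl
next6^-to-zero (suc (suc (suc (suc (suc zero))))) = refl

opp6-involutive : ∀ i → opp6 (opp6 i) ≡ i
opp6-involutive = next6⁶≡id

opp6-≢ : ∀ i → opp6 i ≢ i
opp6-≢ zero ()
opp6-≢ (suc zero) ()
opp6-≢ (suc (suc zero)) ()
opp6-≢ (suc (suc (suc zero))) ()
opp6-≢ (suc (suc (suc (suc zero)))) ()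
opp6-≢ (suc (suc (suc (suc (suc zero))))) ()

ρ-dir : ∀ i → ρ (dir i) ≡ dir (next6 i)
ρ-dir zero = refl
ρ-dir (suc zero) = refl
ρ-dir (suc (suc zero)) = refl
ρ-dir (suc (suc (suc zero))) = refl
ρ-dir (suc (suc (suc (suc zero)))) = refl
ρ-dir (suc (suc (suc (suc (suc zero))))) = refl

ρ^-dir : ∀ k i → ρ^ k (dir i) ≡ dir (next6^ k i)
ρ^-dir zero i = refl
ρ^-dir (suc k) i = trans (cong ρ (ρ^-dir k i)) (ρ-dir (next6^ k i))

dir-opp6 : ∀ i → dir (opp6 i) ≡ -ᵖ dir i
dir-opp6 zero = refl
dir-opp6 (suc zero) = refl
dir-opp6 (suc (suc zero)) = refl
dir-opp6 (suc (suc (suc zero))) = refl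
dir-opp6 (suc (suc (suc (suc zero)))) = refl
dir-opp6 (suc (suc (suc (suc (suc zero))))) = refl

rot180-involutive : ∀ c d → rot180 c (rot180 c d) ≡ d
rot180-involutive (c₁ , c₂) ((h₁ , h₂) , i) =
  cong₂ _,_ (lemma c₁ h₁ ,≡ lemma c₂ h₂) (opp6-involutive i)
  where
  lemma : ∀ c h → + 2 * c - (+ 2 * c - h) ≡ h
  lemma = solve-∀

rev-rot180 : ∀ c d → rev (rot180 c d) ≡ rot180 c (rev d)
rev-rot180 c (h , i) =
  cong (_, opp6 (opp6 i)) (trans (cong ((((+ 2) ⊙ c) ⊖ h) ⊕_) (dir-opp6 i)) (lemma c h (dir i)))
  where
  lemma′ : ∀ c h x → (+ 2 * c - h) + - x ≡ + 2 * c - (h + x)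
  lemma′ = solve-∀
  lemma : ∀ c h x → (((+ 2) ⊙ c) ⊖ h) ⊕ (-ᵖ x) ≡ ((+ 2) ⊙ c) ⊖ (h ⊕ x)
  lemma (c₁ , c₂) (h₁ , h₂) (x₁ , x₂) = lemma′ c₁ h₁ x₁ ,≡ lemma′ c₂ h₂ x₂

act-++ : ∀ cs ds d → act (cs ++ ds) d ≡ act cs (act ds d)
act-++ [] ds d = refl
act-++ (c ∷ cs) ds d = cong (rot180 c) (act-++ cs ds d)

act-rev : ∀ cs d → act cs (rev d) ≡ rev (act cs d)
act-rev [] d = refl
act-rev (c ∷ cs) d = trans (cong (rot180 c) (act-rev cs d)) (sym (rev-rot180 c (act cs d)))

act-faceNext : ∀ cs d → act cs (faceNext d) ≡ faceNext (act cs d)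
act-faceNext [] d = refl
act-faceNext (c ∷ cs) d = cong (rot180 c) (act-faceNext cs d)

dart-induction : (Q : Dart → Set) → (∀ d → Q d → Q (rev d)) → (∀ d → Q d → Q (faceNext d)) →
  ∀ {d₀} → Q d₀ → ∀ d → Q d
dart-induction Q Q-rev Q-faceNext {h₀ , i₀} q₀ (h , i) =
  subst (λ h → Q (h , i)) (p⊕[q⊖p]≡q h₀ h) (everywhere (h ⊖ h₀) i)
  where
  turn : ∀ {h i} k → Q (h , i) → Q (h , next6^ k i)
  turn zero q = q
  turn {h} {i} (suc k) q = Q-faceNext (h , next6^ k i) (turn k q)
  Hex : Pt → Set
  Hex h = ∀ i → Q (h , i)
  around : ∀ {h i} → Q (h , i) → Hex h
  around {h} {i} q j = subst (λ j → Q (h , j)) (next6^-toℕ j)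
    (turn (toℕ j) (subst (λ i → Q (h , i)) (next6^-to-zero i) (turn (6 ℕ.∸ toℕ i) q)))
  step : ∀ {h} i → Hex h → Hex (h ⊕ dir i)
  step {h} i q = around (Q-rev (h , i) (q i))
  lemma₁ : ∀ h x → (h + x) + + 0 ≡ h + x
  lemma₁ = solve-∀
  lemma₂ : ∀ h y b → (h + y) + b ≡ h + (b + y)
  lemma₂ = solve-∀
  shiftʸ : ∀ h x y b → (h ⊕ (x , y)) ⊕ (+ 0 , b) ≡ h ⊕ (x , b + y)
  shiftʸ (h₁ , h₂) x y b = lemma₁ h₁ x ,≡ lemma₂ h₂ y b
  shiftˣ : ∀ h x y a → (h ⊕ (x , y)) ⊕ (a , + 0) ≡ h ⊕ (a + x , y)
  shiftˣ (h₁ , h₂) x y a = lemma₂ h₁ x a ,≡ lemma₁ h₂ y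
  column : ∀ y → Hex (h₀ ⊕ (+ 0 , y))
  column = ℤ-induction (λ y → Hex (h₀ ⊕ (+ 0 , y)))
    (subst Hex (sym (p⊕0≡p h₀)) (around q₀))
    (λ y q → subst Hex (shiftʸ h₀ (+ 0) y (+ 1)) (step zero q))
    (λ y q → subst Hex (shiftʸ h₀ (+ 0) y (- + 1)) (step (suc (suc (suc zero))) q))
  everywhere : ∀ p → Hex (h₀ ⊕ p)
  everywhere (x , y) = ℤ-induction (λ x → Hex (h₀ ⊕ (x , y))) (column y)
    (λ x q → subst Hex (shiftˣ h₀ x y (+ 1)) (step (suc (suc (suc (suc (suc zero))))) q))
    (λ x q → subst Hex (shiftˣ h₀ x y (- + 1)) (step (suc (suc zero)) q))
    x

motionᵖ : Pt → ℕ → Pt → Pt → Pt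
motionᵖ o k t h = ρ^ k (h ⊖ o) ⊕ t

motion : Pt → ℕ → Pt → Dart → Dart
motion o k t (h , i) = (motionᵖ o k t h , next6^ k i)

module _ (o : Pt) where

  motionᵖ-centre : ∀ k t → motionᵖ o k t o ≡ t
  motionᵖ-centre k t =
    trans (cong (λ x → ρ^ k x ⊕ t) (p⊖p≡0 o)) (trans (cong (_⊕ t) (ρ^-0 k)) (0⊕p≡p t))

  motion-faceNext : ∀ k t d → motion o k t (faceNext d) ≡ faceNext (motion o k t d)
  motion-faceNext k t (h , i) = cong (motionᵖ o k t h ,_) (next6^-next6 k i)

  motion-rev : ∀ k t d → motion o k t (rev d) ≡ rev (motion o k t d)
  motion-rev k t (h , i) = cong₂ _,_ position (next6^-opp6 k i)
    where
    open ≡-Reasoning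
    lemma′ : ∀ x y z → (x + y) + z ≡ (x + z) + y
    lemma′ = solve-∀
    lemma : ∀ x y z → (x ⊕ y) ⊕ z ≡ (x ⊕ z) ⊕ y
    lemma (x₁ , x₂) (y₁ , y₂) (z₁ , z₂) = lemma′ x₁ y₁ z₁ ,≡ lemma′ x₂ y₂ z₂
    position : motionᵖ o k t (h ⊕ dir i) ≡ motionᵖ o k t h ⊕ dir (next6^ k i)
    position = begin
      ρ^ k ((h ⊕ dir i) ⊖ o) ⊕ t
        ≡⟨ cong (λ x → ρ^ k x ⊕ t) ([p⊕q]⊖r≡[p⊖r]⊕q h (dir i) o) ⟩
      ρ^ k ((h ⊖ o) ⊕ dir i) ⊕ t
        ≡⟨ cong (_⊕ t) (ρ^-⊕ k (h ⊖ o) (dir i)) ⟩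
      (ρ^ k (h ⊖ o) ⊕ ρ^ k (dir i)) ⊕ t
        ≡⟨ cong (λ x → (ρ^ k (h ⊖ o) ⊕ x) ⊕ t) (ρ^-dir k i) ⟩
      (ρ^ k (h ⊖ o) ⊕ dir (next6^ k i)) ⊕ t
        ≡⟨ lemma (ρ^ k (h ⊖ o)) (dir (next6^ k i)) t ⟩
      (ρ^ k (h ⊖ o) ⊕ t) ⊕ dir (next6^ k i) ∎

  motion-rot180 : ∀ k t c d → motion o k t (rot180 c d) ≡ rot180 (motionᵖ o k t c) (motion o k t d)
  motion-rot180 k t c (h , i) = cong₂ _,_ position (next6^-opp6 k i)
    where
    open ≡-Reasoning
    lemma₁′ : ∀ c h o → ((+ 2) * c - h) - o ≡ (+ 2) * (c - o) - (h - o)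
    lemma₁′ = solve-∀
    lemma₁ : ∀ c h → (((+ 2) ⊙ c) ⊖ h) ⊖ o ≡ ((+ 2) ⊙ (c ⊖ o)) ⊖ (h ⊖ o)
    lemma₁ (c₁ , c₂) (h₁ , h₂) = lemma₁′ c₁ h₁ (proj₁ o) ,≡ lemma₁′ c₂ h₂ (proj₂ o)
    lemma₂′ : ∀ x y t → ((+ 2) * x - y) + t ≡ (+ 2) * (x + t) - (y + t)
    lemma₂′ = solve-∀
    lemma₂ : ∀ x y → (((+ 2) ⊙ x) ⊖ y) ⊕ t ≡ ((+ 2) ⊙ (x ⊕ t)) ⊖ (y ⊕ t)
    lemma₂ (x₁ , x₂) (y₁ , y₂) = lemma₂′ x₁ y₁ (proj₁ t) ,≡ lemma₂′ x₂ y₂ (proj₂ t)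
    position : motionᵖ o k t (((+ 2) ⊙ c) ⊖ h) ≡ ((+ 2) ⊙ motionᵖ o k t c) ⊖ motionᵖ o k t h
    position = begin
      ρ^ k ((((+ 2) ⊙ c) ⊖ h) ⊖ o) ⊕ t
        ≡⟨ cong (λ x → ρ^ k x ⊕ t) (lemma₁ c h) ⟩
      ρ^ k (((+ 2) ⊙ (c ⊖ o)) ⊖ (h ⊖ o)) ⊕ t
        ≡⟨ cong (_⊕ t) (trans (ρ^-⊖ k _ _) (cong (_⊖ ρ^ k (h ⊖ o)) (ρ^-⊙ k (+ 2) (c ⊖ o)))) ⟩
      (((+ 2) ⊙ ρ^ k (c ⊖ o)) ⊖ ρ^ k (h ⊖ o)) ⊕ t
        ≡⟨ lemma₂ (ρ^ k (c ⊖ o)) (ρ^ k (h ⊖ o)) ⟩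
      ((+ 2) ⊙ (ρ^ k (c ⊖ o) ⊕ t)) ⊖ (ρ^ k (h ⊖ o) ⊕ t) ∎

  motion-act : ∀ k t cs d → motion o k t (act cs d) ≡ act (map (motionᵖ o k t) cs) (motion o k t d)
  motion-act k t [] d = refl
  motion-act k t (c ∷ cs) d =
    trans (motion-rot180 k t c (act cs d)) (cong (rot180 (motionᵖ o k t c)) (motion-act k t cs d))

  rotation-∘ : ∀ k m d → motion o k o (motion o m o d) ≡ motion o (k ℕ.+ m) o d
  rotation-∘ k m (h , i) =
    cong₂ _,_ (trans (cong (λ x → ρ^ k x ⊕ o) ([p⊕q]⊖q≡p (ρ^ m (h ⊖ o)) o))
                     (cong (_⊕ o) (sym (ρ^-+ k m (h ⊖ o)))))
              (sym (next6^-+ k m i))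

  rotation-6 : ∀ d → motion o 6 o d ≡ d
  rotation-6 (h , i) =
    cong₂ _,_ (trans (cong (_⊕ o) (ρ⁶≡id (h ⊖ o))) ([p⊖q]⊕q≡p h o)) (next6⁶≡id i)

  halfTurn-∘³ : ∀ t d → motion o 3 t (motion o 3 t (motion o 3 t d)) ≡ motion o 3 t d
  halfTurn-∘³ t (h , i) = cong₂ _,_ position (next6⁶≡id (next6^ 3 i))
    where
    open ≡-Reasoning
    lemma′ : ∀ h o t → - ((- ((- (h - o) + t) - o) + t) - o) + t ≡ - (h - o) + t
    lemma′ = solve-∀
    reflect : Pt → Pt
    reflect x = (-ᵖ (x ⊖ o)) ⊕ t
    halfTurn : ∀ x → motionᵖ o 3 t x ≡ reflect x
    halfTurn x = cong (_⊕ t) (ρ³≡-ᵖ (x ⊖ o))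
    reflect-∘³ : ∀ x → reflect (reflect (reflect x)) ≡ reflect x
    reflect-∘³ (x₁ , x₂) = lemma′ x₁ (proj₁ o) (proj₁ t) ,≡ lemma′ x₂ (proj₂ o) (proj₂ t)
    position : motionᵖ o 3 t (motionᵖ o 3 t (motionᵖ o 3 t h)) ≡ motionᵖ o 3 t h
    position = begin
      motionᵖ o 3 t (motionᵖ o 3 t (motionᵖ o 3 t h)) ≡⟨ halfTurn (motionᵖ o 3 t (motionᵖ o 3 t h)) ⟩
      reflect (motionᵖ o 3 t (motionᵖ o 3 t h))        ≡⟨ cong reflect (halfTurn (motionᵖ o 3 t h)) ⟩
      reflect (reflect (motionᵖ o 3 t h))              ≡⟨ cong (λ x → reflect (reflect x)) (halfTurn h) ⟩
      reflect (reflect (reflect h))                    ≡⟨ reflect-∘³ h ⟩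
      reflect h                                        ≡⟨ sym (halfTurn h) ⟩
      motionᵖ o 3 t h                                  ∎

-- Orbits

module Orbits (o u v : Pt) where

  open SpecialHexagons o u v

  infix 4 _~_
  _~_ : Dart → Dart → Set
  _~_ = SameOrbit o u v

  ~-reflexive : ∀ {d d′} → d ≡ d′ → d ~ d′
  ~-reflexive d≡d′ = [] , [] , d≡d′

  ~-trans : ∀ {d d′ d″} → d ~ d′ → d′ ~ d″ → d ~ d″
  ~-trans {d} (cs , A , refl) (ds , B , refl) = ds ++ cs , All.++⁺ B A , act-++ ds cs d

  rot180-~ : ∀ c d → Special o u v c → rot180 c d ~ d
  rot180-~ c d sc = c ∷ [] , sc ∷ [] , rot180-involutive c d

  ~-sym : ∀ {d d′} → d ~ d′ → d′ ~ d
  ~-sym {d} (cs , A , refl) = act-~ cs A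
    where
    act-~ : ∀ cs → All (Special o u v) cs → act cs d ~ d
    act-~ [] [] = ~-reflexive refl
    act-~ (c ∷ cs) (sc ∷ A) = ~-trans (rot180-~ c (act cs d) sc) (act-~ cs A)

  ~-rev : ∀ {d d′} → d ~ d′ → rev d ~ rev d′
  ~-rev {d} (cs , A , refl) = cs , A , act-rev cs d

  ~-faceNext : ∀ {d d′} → d ~ d′ → faceNext d ~ faceNext d′
  ~-faceNext {d} (cs , A , refl) = cs , A , act-faceNext cs d

  InDoubleLat : Pt → Set
  InDoubleLat = InLat ((+ 2) ⊙ u) ((+ 2) ⊙ v)

  -- A half-turn about a special hexagon c reverses the side index and sends
  -- h to 2c - h ≡ 2o - h (mod 2Λ), so these are the invariants of an orbit.
  Congruent : Dart → Dart → Set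
  Congruent (h , i) (h′ , i′) =
    (i′ ≡ i × InDoubleLat (h′ ⊖ h)) ⊎ (i′ ≡ opp6 i × InDoubleLat ((h′ ⊕ h) ⊖ ((+ 2) ⊙ o)))

  congruent-refl : ∀ d → Congruent d d
  congruent-refl (h , i) = inj₁ (refl , subst InDoubleLat (sym (p⊖p≡0 h)) InLat-0)

  congruent-rot180 : ∀ c → Special o u v c → ∀ d d′ → Congruent d d′ → Congruent d (rot180 c d′)
  congruent-rot180 c sc (h , i) (h′ , i′) (inj₁ (i′≡i , l)) =
    inj₂ (cong opp6 i′≡i , subst InDoubleLat (sym (lemma₁ c h h′)) (InLat-⊖ (InLat-double sc) l))
    where
    lemma′ : ∀ c h h′ o → ((+ 2 * c - h′) + h) - + 2 * o ≡ + 2 * (c - o) - (h′ - h)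
    lemma′ = solve-∀
    lemma₁ : ∀ c h h′ → ((((+ 2) ⊙ c) ⊖ h′) ⊕ h) ⊖ ((+ 2) ⊙ o) ≡ ((+ 2) ⊙ (c ⊖ o)) ⊖ (h′ ⊖ h)
    lemma₁ (c₁ , c₂) (h₁ , h₂) (h′₁ , h′₂) =
      lemma′ c₁ h₁ h′₁ (proj₁ o) ,≡ lemma′ c₂ h₂ h′₂ (proj₂ o)
  congruent-rot180 c sc (h , i) (h′ , i′) (inj₂ (i′≡-i , l)) =
    inj₁ (trans (cong opp6 i′≡-i) (opp6-involutive i) ,
          subst InDoubleLat (sym (lemma₂ c h h′)) (InLat-⊖ (InLat-double sc) l))
    where
    lemma′ : ∀ c h h′ o → (+ 2 * c - h′) - h ≡ + 2 * (c - o) - ((h′ + h) - + 2 * o)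
    lemma′ = solve-∀
    lemma₂ : ∀ c h h′ → (((+ 2) ⊙ c) ⊖ h′) ⊖ h ≡ ((+ 2) ⊙ (c ⊖ o)) ⊖ ((h′ ⊕ h) ⊖ ((+ 2) ⊙ o))
    lemma₂ (c₁ , c₂) (h₁ , h₂) (h′₁ , h′₂) =
      lemma′ c₁ h₁ h′₁ (proj₁ o) ,≡ lemma′ c₂ h₂ h′₂ (proj₂ o)

  ~⇒congruent : ∀ {d d′} → d ~ d′ → Congruent d d′
  ~⇒congruent {d} (cs , A , refl) = go cs A
    where
    go : ∀ cs → All (Special o u v) cs → Congruent d (act cs d)
    go [] [] = congruent-refl d
    go (c ∷ cs) (sc ∷ A) = congruent-rot180 c sc d (act cs d) (go cs A)

  translation-~ : ∀ {x} → InDoubleLat x → ∀ h i → (h , i) ~ (h ⊕ x , i)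
  translation-~ (a , b , refl) h i =
    (o ⊕ r) ∷ o ∷ [] , Special-shift (a , b , refl) ∷ Special-centre ∷ [] ,
    cong₂ _,_ (lemma′ (proj₁ o) a (proj₁ u) b (proj₁ v) (proj₁ h) ,≡
               lemma′ (proj₂ o) a (proj₂ u) b (proj₂ v) (proj₂ h))
              (opp6-involutive i)
    where
    r : Pt
    r = (a ⊙ u) ⊕ (b ⊙ v)
    lemma′ : ∀ o a u b v h →
      + 2 * (o + (a * u + b * v)) - (+ 2 * o - h) ≡ h + (a * (+ 2 * u) + b * (+ 2 * v))
    lemma′ = solve-∀

  PreservesOrbits : (Dart → Dart) → Set
  PreservesOrbits F = ∀ d d′ → d ~ d′ → F d ~ F d′

  Order3OnOrbits : (Dart → Dart) → Set
  Order3OnOrbits F = PreservesOrbits F × (∀ d → F (F (F d)) ~ d) × Σ Dart (λ d → ¬ F d ~ d)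

  Order3OnOrbits-cong : ∀ {F G} → (∀ d → F d ~ G d) → Order3OnOrbits F → Order3OnOrbits G
  Order3OnOrbits-cong {F} {G} F~G (preserves , cube , d , nontrivial) =
    preservesG , (λ d → ~-trans (~-sym (F∘F∘F~G∘G∘G d)) (cube d)) ,
    d , λ Gd~d → nontrivial (~-trans (F~G d) Gd~d)
    where
    preservesG : PreservesOrbits G
    preservesG d d′ d~d′ = ~-trans (~-sym (F~G d)) (~-trans (preserves d d′ d~d′) (F~G d′))
    F∘F~G∘G : ∀ d → F (F d) ~ G (G d)
    F∘F~G∘G d = ~-trans (preserves (F d) (G d) (F~G d)) (F~G (G d))
    F∘F∘F~G∘G∘G : ∀ d → F (F (F d)) ~ G (G (G d))
    F∘F∘F~G∘G∘G d = ~-trans (preserves (F (F d)) (G (G d)) (F∘F~G∘G d)) (F~G (G (G d)))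

  agree-everywhere : ∀ (F G : Dart → Dart) →
    (∀ d → F (rev d) ~ rev (F d)) → (∀ d → F (faceNext d) ~ faceNext (F d)) →
    (∀ d → G (rev d) ≡ rev (G d)) → (∀ d → G (faceNext d) ≡ faceNext (G d)) →
    ∀ {d₀} → F d₀ ~ G d₀ → ∀ d → F d ~ G d
  agree-everywhere F G F-rev F-faceNext G-rev G-faceNext =
    dart-induction (λ d → F d ~ G d) agree-rev agree-faceNext
    where
    agree-rev : ∀ d → F d ~ G d → F (rev d) ~ G (rev d)
    agree-rev d q = ~-trans (F-rev d) (~-trans (~-rev q) (~-reflexive (sym (G-rev d))))
    agree-faceNext : ∀ d → F d ~ G d → F (faceNext d) ~ G (faceNext d)
    agree-faceNext d q = ~-trans (F-faceNext d) (~-trans (~-faceNext q) (~-reflexive (sym (G-faceNext d))))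

  motion-offset : ∀ k t → PreservesOrbits (motion o k t) →
    ∀ c → Special o u v c → InLat u v (ρ^ k (c ⊖ o) ⊕ (t ⊖ o))
  motion-offset k t preserves c sc with ~⇒congruent (preserves _ _ (rot180-~ c (o , zero) sc))
  ... | inj₁ (i′≡i , _) = ⊥-elim (opp6-≢ (next6^ k zero) (trans (sym (next6^-opp6 k zero)) (sym i′≡i)))
  ... | inj₂ (_ , l) = InLat-halve (subst InDoubleLat position l)
    where
    lemma′ : ∀ x t o → (t + (+ 2 * x + t)) - + 2 * o ≡ + 2 * (x + (t - o))
    lemma′ = solve-∀
    lemma : ∀ x → (t ⊕ (((+ 2) ⊙ x) ⊕ t)) ⊖ ((+ 2) ⊙ o) ≡ (+ 2) ⊙ (x ⊕ (t ⊖ o))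
    lemma (x₁ , x₂) = lemma′ x₁ (proj₁ t) (proj₁ o) ,≡ lemma′ x₂ (proj₂ t) (proj₂ o)
    double′ : ∀ c o → ((+ 2) * c - o) - o ≡ (+ 2) * (c - o)
    double′ = solve-∀
    double : (((+ 2) ⊙ c) ⊖ o) ⊖ o ≡ (+ 2) ⊙ (c ⊖ o)
    double = double′ (proj₁ c) (proj₁ o) ,≡ double′ (proj₂ c) (proj₂ o)
    position : (motionᵖ o k t o ⊕ motionᵖ o k t (((+ 2) ⊙ c) ⊖ o)) ⊖ ((+ 2) ⊙ o) ≡
               (+ 2) ⊙ (ρ^ k (c ⊖ o) ⊕ (t ⊖ o))
    position = trans (cong₂ (λ a x → (a ⊕ (x ⊕ t)) ⊖ ((+ 2) ⊙ o)) (motionᵖ-centre o k t)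
      (trans (cong (ρ^ k) double) (ρ^-⊙ k (+ 2) (c ⊖ o)))) (lemma (ρ^ k (c ⊖ o)))

  motion-translationPart : ∀ k t → PreservesOrbits (motion o k t) → InLat u v (t ⊖ o)
  motion-translationPart k t preserves =
    subst (InLat u v) (motionᵖ-centre o k (t ⊖ o)) (motion-offset k t preserves o Special-centre)

  motion⇒closedUnderρ^ : ∀ k t → PreservesOrbits (motion o k t) → ClosedUnderρ^ k u v
  motion⇒closedUnderρ^ k t preserves {p} l =
    subst (InLat u v) (trans ([p⊕q]⊖q≡p _ (t ⊖ o)) (cong (ρ^ k) ([p⊕q]⊖p≡q o p)))
      (InLat-⊖ (motion-offset k t preserves (o ⊕ p) (Special-shift l)) (motion-translationPart k t preserves))

  translation-order3⇒trivial : ∀ t → PreservesOrbits (motion o 0 t) →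
    (∀ d → motion o 0 t (motion o 0 t (motion o 0 t d)) ~ d) → ∀ d → motion o 0 t d ~ d
  translation-order3⇒trivial t preserves cube (h , i) with ~⇒congruent (cube (h , i))
  ... | inj₂ (i≡-i , _) = ⊥-elim (opp6-≢ i (sym i≡-i))
  ... | inj₁ (_ , l) =
    ~-trans (translation-~ (InLat-⊕ l (InLat-double (motion-translationPart 0 t preserves))) _ i)
            (~-reflexive (cong (_, i) (lemma h)))
    where
    lemma′ : ∀ h o t → ((h - o) + t) + ((h - ((((((h - o) + t) - o) + t) - o) + t)) + + 2 * (t - o)) ≡ h
    lemma′ = solve-∀
    lemma : ∀ h → motionᵖ o 0 t h ⊕
      ((h ⊖ motionᵖ o 0 t (motionᵖ o 0 t (motionᵖ o 0 t h))) ⊕ ((+ 2) ⊙ (t ⊖ o))) ≡ h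
    lemma (h₁ , h₂) = lemma′ h₁ (proj₁ o) (proj₁ t) ,≡ lemma′ h₂ (proj₂ o) (proj₂ t)

  order3Motion⇒rotationClosed : ∀ (j : Fin 6) t → Order3OnOrbits (motion o (toℕ j) t) → RotationClosed u v
  order3Motion⇒rotationClosed zero t (preserves , cube , d , nontrivial) =
    ⊥-elim (nontrivial (translation-order3⇒trivial t preserves cube d))
  order3Motion⇒rotationClosed (suc zero) t (preserves , _) = motion⇒closedUnderρ^ 1 t preserves
  order3Motion⇒rotationClosed (suc (suc zero)) t (preserves , _) =
    closedUnderρ²⇒rotationClosed (motion⇒closedUnderρ^ 2 t preserves)
  order3Motion⇒rotationClosed (suc (suc (suc zero))) t (_ , cube , d , nontrivial) =
    ⊥-elim (nontrivial (~-trans (~-reflexive (sym (halfTurn-∘³ o t d))) (cube d)))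
  order3Motion⇒rotationClosed (suc (suc (suc (suc zero)))) t (preserves , _) =
    closedUnderρ⁴⇒rotationClosed (motion⇒closedUnderρ^ 4 t preserves)
  order3Motion⇒rotationClosed (suc (suc (suc (suc (suc zero))))) t (preserves , _) =
    closedUnderρ⁵⇒rotationClosed (motion⇒closedUnderρ^ 5 t preserves)

  threeFold⇒rotationClosed : ThreeFoldSymmetric o u v → RotationClosed u v
  threeFold⇒rotationClosed (F , preserves , F-rev , F-faceNext , cube , nontrivial) =
    order3Motion⇒rotationClosed j t (Order3OnOrbits-cong F~G (preserves , cube , nontrivial))
    where
    t : Pt
    t = proj₁ (F (o , zero))
    j : Fin 6
    j = proj₂ (F (o , zero))
    G : Dart → Dart
    G = motion o (toℕ j) t
    F~G : ∀ d → F d ~ G d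
    F~G = agree-everywhere F G F-rev F-faceNext (motion-rev o (toℕ j) t) (motion-faceNext o (toℕ j) t)
      (~-reflexive (sym (cong₂ _,_ (motionᵖ-centre o (toℕ j) t) (next6^-toℕ j))))

  rotationClosed⇒threeFold : RotationClosed u v → ThreeFoldSymmetric o u v
  rotationClosed⇒threeFold closed =
    F , preserves ,
    (λ d → ~-reflexive (motion-rev o 2 o d)) , (λ d → ~-reflexive (motion-faceNext o 2 o d)) ,
    (λ d → ~-reflexive cube) , (o , zero) , nontrivial
    where
    F : Dart → Dart
    F = motion o 2 o
    special : ∀ c → Special o u v c → Special o u v (motionᵖ o 2 o c)
    special c sc = subst (InLat u v) (sym ([p⊕q]⊖q≡p _ o)) (rotationClosed⇒closedUnderρ^ closed 2 sc)
    specials : ∀ {cs} → All (Special o u v) cs → All (Special o u v) (map (motionᵖ o 2 o) cs)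
    specials = All.gmap⁺ (λ {c} → special c)
    preserves : PreservesOrbits F
    preserves d _ (cs , A , refl) = map (motionᵖ o 2 o) cs , specials A , sym (motion-act o 2 o cs d)
    cube : ∀ {d} → F (F (F d)) ≡ d
    cube {d} = trans (cong F (rotation-∘ o 2 2 d)) (trans (rotation-∘ o 2 4 d) (rotation-6 o d))
    nontrivial : ¬ F (o , zero) ~ (o , zero)
    nontrivial F[o,0]~[o,0] with ~⇒congruent F[o,0]~[o,0]
    ... | inj₁ (() , _)
    ... | inj₂ (() , _)

proposition2 : (o u v : Pt) → det u v ≢ ℤ.pos 0 →
    (ThreeFoldSymmetric o u v ⇔ AllSignaturesEqual u v) ×
    (AllSignaturesEqual u v ⇔ TwoSignaturesEqual u v) ×
    (TwoSignaturesEqual u v ⇔ SixFoldAtSpecials o u v) ×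
    (SixFoldAtSpecials o u v ⇔ SomeThreeFoldRotation o u v)
proposition2 o u v det≢0 =
  via threeFold⇔ allSignatures⇔ , via allSignatures⇔ twoSignatures⇔ ,
  via twoSignatures⇔ sixFold⇔ , via sixFold⇔ someThreeFold⇔
  where
  open SignatureConditions u v
  open SpecialHexagons o u v
  open Orbits o u v
  via : ∀ {A B : Set} → A ⇔ RotationClosed u v → B ⇔ RotationClosed u v → A ⇔ B
  via A⇔R B⇔R = ⇔-sym B⇔R ⇔-∘ A⇔R
  threeFold⇔ : ThreeFoldSymmetric o u v ⇔ RotationClosed u v
  threeFold⇔ = mk⇔ threeFold⇒rotationClosed rotationClosed⇒threeFold
  twoSignatures⇔ : TwoSignaturesEqual u v ⇔ RotationClosed u v
  twoSignatures⇔ = mk⇔ twoSignaturesEqual⇒rotationClosed (rotationClosed⇒twoSignaturesEqual det≢0)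
  allSignatures⇔ : AllSignaturesEqual u v ⇔ RotationClosed u v
  allSignatures⇔ = mk⇔ allSignaturesEqual⇒rotationClosed (rotationClosed⇒allSignaturesEqual det≢0)
  sixFold⇔ : SixFoldAtSpecials o u v ⇔ RotationClosed u v
  sixFold⇔ = mk⇔ sixFold⇒rotationClosed rotationClosed⇒sixFold
  someThreeFold⇔ : SomeThreeFoldRotation o u v ⇔ RotationClosed u v
  someThreeFold⇔ = mk⇔ someThreeFold⇒rotationClosed rotationClosed⇒someThreeFold
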